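{- Let $M$ be a DFA with $n \ge 2$ states. If $L(M)$ is not subword-free, there exists a witness $(u,w)$ to the failure of subword-freeness with $|w| \le 2n-1$. Furthermore, this is the best possible bound: there exists a DFA with $n$ states over a one-letter alphabet whose language is not subword-free and every witness $(u,w)$ of which satisfies $|w| \ge 2n-1$.
   Context: A word $u$ is a subword of $w$ if $u$ can be obtained from $w$ by deleting some (not necessarily contiguous) letters. $L$ is subword-free if no word of $L$ has a subword different from itself in $L$. A witness to the failure of subword-freeness is a pair $(u,w)$ with $u,w \in L$, $u$ a subword of $w$, $u \ne w$. -}

module Defs where

open import Data.Nat using (ℕ; suc; _+_; _*_; _∸_; _≤_)
open import Data.Fin using (Fin)
open import Data.Bool using (Bool; true)
open import Data.List using (List; []; _∷_; length)
open import Data.List.Relation.Binary.Sublist.Propositional using (_⊆_)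
open import Relation.Binary.PropositionalEquality using (_≡_)
open import Relation.Nullary using (¬_)
open import Data.Product using (_×_; Σ)

record DFA (k n : ℕ) : Set where
  field
    δ      : Fin n → Fin k → Fin n
    start  : Fin n
    accept : Fin n → Bool

open DFA public

δ* : ∀ {k n} → DFA k n → Fin n → List (Fin k) → Fin n
δ* M q []       = q
δ* M q (a ∷ w)  = δ* M (δ M q a) w

Accepts : ∀ {k n} → DFA k n → List (Fin k) → Set
Accepts M w = accept M (δ* M (start M) w) ≡ true

Subword : ∀ {k} → List (Fin k) → List (Fin k) → Set
Subword u w = u ⊆ w

Witness : ∀ {k n} → DFA k n → List (Fin k) → List (Fin k) → Set
Witness M u w = Accepts M u × Accepts M w × Subword u w × ¬ (u ≡ w)

SubwordFree : ∀ {k n} → DFA k n → Set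
SubwordFree M = ∀ u w → ¬ Witness M u w

NotSubwordFree : ∀ {k n} → DFA k n → Set
NotSubwordFree {k} M = Σ (List (Fin k)) λ u → Σ (List (Fin k)) λ w → Witness M u w

-- A word of length at least 2n splits as v₁ v₂ c with |v₁| = |v₂| = n.  By
-- pigeonhole the run on v₁ repeats a state, so an infix of v₁ can be cut out
-- without changing the state reached; do the same inside v₂.  Cutting only v₁
-- gives a shorter accepted word w′, cutting both gives an accepted proper subword
-- of w′.  Hence a witness (u, w) with |w| ≥ 2n can be replaced by one with a
-- shorter w, until |w| ≤ 2n − 1.  The bound is attained by the unary cycle on n
-- states accepting the lengths ≡ n − 1 (mod n): its shortest proper subword pair
-- is (aⁿ⁻¹, a²ⁿ⁻¹).
module Submission where

open import Defs
open import Data.Nat using (ℕ; NonZero; zero; suc; _+_; _*_; _∸_; _≤_; _<_; _≡ᵇ_; s≤s⁻¹)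
open import Data.Nat.Properties
open import Data.Nat.DivMod using (_%_; _/_; m%n<n; m%n≤m; m≡m%n+[m/n]*n; %-distribˡ-+; m%n%n≡m%n; [m+n]%n≡m%n; m<n⇒m%n≡m)
open import Data.Nat.Induction using (<-wellFounded)
open import Data.List using (List; []; _∷_; length; _++_; take; drop; replicate)
open import Data.List.Properties using (length-++; length-take; take++drop≡id; length-replicate)
open import Data.List.Relation.Binary.Sublist.Propositional using (_⊆_; ⊆-refl)
open import Data.List.Relation.Binary.Sublist.Propositional.Properties using (++⁺; ++⁺ʳ; take⁺; length-mono-≤; to-≋)
open import Data.List.Relation.Binary.Equality.Propositional using (≋⇒≡)
open import Data.Fin using (Fin; zero; toℕ; fromℕ<)
open import Data.Fin.Properties using (pigeonhole; toℕ<n; toℕ-fromℕ<)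
open import Data.Bool.Properties using (T-≡)
open import Function.Bundles using (Equivalence)
open import Data.Product using (Σ; ∃-syntax; ∃₂; _×_; _,_)
open import Induction.WellFounded using (Acc; acc)
open import Relation.Nullary using (¬_; yes; no)
open import Relation.Binary.PropositionalEquality

length-++₃ : ∀ {A : Set} (x y z : List A) → length (x ++ y ++ z) ≡ length x + (length y + length z)
length-++₃ x y z = trans (length-++ x) (cong (length x +_) (length-++ y))

length-infix-< : ∀ {A : Set} (x y′ y z : List A) →
  length y′ < length y → length (x ++ y′ ++ z) < length (x ++ y ++ z)
length-infix-< x y′ y z y′<y =
  subst₂ _<_ (sym (length-++₃ x y′ z)) (sym (length-++₃ x y z))
    (+-monoʳ-< (length x) (+-monoˡ-< (length z) y′<y))

⊆∧≢⇒length< : ∀ {A : Set} {u w : List A} → u ⊆ w → u ≢ w → length u < length w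
⊆∧≢⇒length< u⊆w u≢w = ≤∧≢⇒< (length-mono-≤ u⊆w) (λ same → u≢w (≋⇒≡ (to-≋ same u⊆w)))

≰2n∸1⇒n+n≤ : ∀ n {ℓ} → ¬ ℓ ≤ 2 * n ∸ 1 → n + n ≤ ℓ
≰2n∸1⇒n+n≤ n {ℓ} long =
  subst (_≤ ℓ) (cong (n +_) (+-identityʳ n)) (≤-trans (m≤n+m∸n (2 * n) 1) (≰⇒> long))

split₃ : ∀ {A : Set} m n (w : List A) → m + n ≤ length w →
  ∃[ a ] ∃[ b ] ∃[ c ] w ≡ a ++ b ++ c × length a ≡ m × length b ≡ n
split₃ zero n w n≤∣w∣ =
  [] , take n w , drop n w , sym (take++drop≡id n w) , refl , trans (length-take n w) (m≤n⇒m⊓n≡m n≤∣w∣)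
split₃ (suc m) n (x ∷ w) m+n<∣w∣
  with a , b , c , refl , ∣a∣≡m , ∣b∣≡n ← split₃ m n w (s≤s⁻¹ m+n<∣w∣) =
  x ∷ a , b , c , refl , cong suc ∣a∣≡m , ∣b∣≡n

module _ {k n : ℕ} (M : DFA k n) where

  δ*-++ : ∀ q (x y : List (Fin k)) → δ* M q (x ++ y) ≡ δ* M (δ* M q x) y
  δ*-++ q []      y = refl
  δ*-++ q (a ∷ x) y = δ*-++ (δ M q a) x y

  δ*-++-congˡ : ∀ q (x′ x t : List (Fin k)) →
    δ* M q x′ ≡ δ* M q x → δ* M q (x′ ++ t) ≡ δ* M q (x ++ t)
  δ*-++-congˡ q x′ x t same = begin
    δ* M q (x′ ++ t)        ≡⟨ δ*-++ q x′ t ⟩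
    δ* M (δ* M q x′) t      ≡⟨ cong (λ p → δ* M p t) same ⟩
    δ* M (δ* M q x) t       ≡⟨ δ*-++ q x t ⟨
    δ* M q (x ++ t)         ∎
    where open ≡-Reasoning

  accepts-resp : ∀ u w → δ* M (start M) u ≡ δ* M (start M) w → Accepts M w → Accepts M u
  accepts-resp u w same accepted = trans (cong (accept M) same) accepted

  -- The n + 1 prefixes of v of length ≤ n lead to a common state; cut out the
  -- letters between two of them.
  loop-removal : ∀ q (v : List (Fin k)) → n ≤ length v →
    ∃[ v′ ] v′ ⊆ v × length v′ < length v × δ* M q v′ ≡ δ* M q v
  loop-removal q v n≤∣v∣
    with i , j , i<j , same ← pigeonhole (n<1+n n) (λ (i : Fin (suc n)) → δ* M q (take (toℕ i) v)) =
    x ++ z , sub , shorter , run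
    where
    x = take (toℕ i) v
    y = take (toℕ j) v
    z = drop (toℕ j) v
    split : y ++ z ≡ v
    split = take++drop≡id (toℕ j) v
    sub : x ++ z ⊆ v
    sub = subst (x ++ z ⊆_) split (++⁺ (take⁺ (<⇒≤ i<j)) ⊆-refl)
    x-shorter : length x < length y
    x-shorter = subst₂ _<_ (sym (length-take (toℕ i) v)) (sym (length-take (toℕ j) v))
      (<-≤-trans (≤-<-trans (m⊓n≤m (toℕ i) (length v)) i<j)
        (≤-reflexive (sym (m≤n⇒m⊓n≡m (≤-trans (s≤s⁻¹ (toℕ<n j)) n≤∣v∣)))))
    shorter : length (x ++ z) < length v
    shorter = subst (length (x ++ z) <_) (cong length split) (length-infix-< [] x y z x-shorter)
    run : δ* M q (x ++ z) ≡ δ* M q v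
    run = trans (δ*-++-congˡ q x y z same) (cong (δ* M q) split)

  shrink : ∀ v₁ v₂ c → n ≤ length v₁ → n ≤ length v₂ → Accepts M (v₁ ++ v₂ ++ c) →
    ∃₂ λ u w → Witness M u w × length w < length (v₁ ++ v₂ ++ c)
  shrink v₁ v₂ c n≤∣v₁∣ n≤∣v₂∣ accepted
    with v₁′ , _ , ∣v₁′∣<∣v₁∣ , run₁ ← loop-removal (start M) v₁ n≤∣v₁∣
       | v₂′ , v₂′⊆v₂ , ∣v₂′∣<∣v₂∣ , run₂ ← loop-removal (δ* M (start M) v₁) v₂ n≤∣v₂∣ =
    v₁′ ++ v₂′ ++ c , v₁′ ++ v₂ ++ c , (accepted-u , accepted-w , sub , u≢w) ,
    length-infix-< [] v₁′ v₁ (v₂ ++ c) ∣v₁′∣<∣v₁∣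
    where
    s = start M
    run-w : δ* M s (v₁′ ++ v₂ ++ c) ≡ δ* M s (v₁ ++ v₂ ++ c)
    run-w = δ*-++-congˡ s v₁′ v₁ (v₂ ++ c) run₁
    run-u : δ* M s (v₁′ ++ v₂′ ++ c) ≡ δ* M s (v₁′ ++ v₂ ++ c)
    run-u = begin
      δ* M s (v₁′ ++ v₂′ ++ c)       ≡⟨ δ*-++-congˡ s v₁′ v₁ (v₂′ ++ c) run₁ ⟩
      δ* M s (v₁ ++ v₂′ ++ c)        ≡⟨ δ*-++ s v₁ (v₂′ ++ c) ⟩
      δ* M (δ* M s v₁) (v₂′ ++ c)    ≡⟨ δ*-++-congˡ (δ* M s v₁) v₂′ v₂ c run₂ ⟩
      δ* M (δ* M s v₁) (v₂ ++ c)     ≡⟨ δ*-++ s v₁ (v₂ ++ c) ⟨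
      δ* M s (v₁ ++ v₂ ++ c)         ≡⟨ run-w ⟨
      δ* M s (v₁′ ++ v₂ ++ c)        ∎
      where open ≡-Reasoning
    accepted-w = accepts-resp (v₁′ ++ v₂ ++ c) (v₁ ++ v₂ ++ c) run-w accepted
    accepted-u = accepts-resp (v₁′ ++ v₂′ ++ c) (v₁′ ++ v₂ ++ c) run-u accepted-w
    sub : v₁′ ++ v₂′ ++ c ⊆ v₁′ ++ v₂ ++ c
    sub = ++⁺ (⊆-refl {x = v₁′}) (++⁺ v₂′⊆v₂ (⊆-refl {x = c}))
    u≢w : v₁′ ++ v₂′ ++ c ≢ v₁′ ++ v₂ ++ c
    u≢w same = <-irrefl (cong length same) (length-infix-< v₁′ v₂′ v₂ c ∣v₂′∣<∣v₂∣)

  short-witness : ∀ {u w} → Acc _<_ (length w) → Witness M u w →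
    ∃₂ λ u′ w′ → Witness M u′ w′ × length w′ ≤ 2 * n ∸ 1
  short-witness {u} {w} (acc rec) witness@(_ , accepted , _) with length w ≤? 2 * n ∸ 1
  ... | yes short = u , w , witness , short
  ... | no long
    with v₁ , v₂ , c , refl , ∣v₁∣≡n , ∣v₂∣≡n ← split₃ n n w (≰2n∸1⇒n+n≤ n long)
    with u′ , w′ , witness′ , ∣w′∣<∣w∣
           ← shrink v₁ v₂ c (≤-reflexive (sym ∣v₁∣≡n)) (≤-reflexive (sym ∣v₂∣≡n)) accepted =
    short-witness (rec ∣w′∣<∣w∣) witness′

[m%n+k]%n≡[m+k]%n : ∀ m k n .{{_ : NonZero n}} → (m % n + k) % n ≡ (m + k) % n
[m%n+k]%n≡[m+k]%n m k n = begin
  (m % n + k) % n            ≡⟨ %-distribˡ-+ (m % n) k n ⟩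
  (m % n % n + k % n) % n    ≡⟨ cong (λ r → (r + k % n) % n) (m%n%n≡m%n m n) ⟩
  (m % n + k % n) % n        ≡⟨ %-distribˡ-+ m k n ⟨
  (m + k) % n                ∎
  where open ≡-Reasoning

-- b = m + (b / (m+1)) (m+1), and the quotient is nonzero because b > a ≥ m.
second-residue-≥ : ∀ {m a b} → a < b → a % suc m ≡ m → b % suc m ≡ m → m + suc m ≤ b
second-residue-≥ {m} {a} {b} a<b a%≡m b%≡m = subst (m + suc m ≤_) (sym b≡m+q*n) (+-monoʳ-≤ m n≤q*n)
  where
  q = b / suc m
  b≡m+q*n : b ≡ m + q * suc m
  b≡m+q*n = trans (m≡m%n+[m/n]*n b (suc m)) (cong (_+ q * suc m) b%≡m)
  m<b : m < b
  m<b = ≤-<-trans (subst (_≤ a) a%≡m (m%n≤m a (suc m))) a<b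
  q≢0 : q ≢ 0
  q≢0 q≡0 = <⇒≢ m<b (sym (trans b≡m+q*n (trans (cong (λ r → m + r * suc m) q≡0) (+-identityʳ m))))
  n≤q*n : suc m ≤ q * suc m
  n≤q*n = subst (_≤ q * suc m) (+-identityʳ (suc m)) (*-monoˡ-≤ (suc m) (n≢0⇒n>0 q≢0))

module Cyclic (m : ℕ) where

  cyclic : DFA 1 (suc m)
  cyclic = record
    { δ      = λ q _ → fromℕ< (m%n<n (suc (toℕ q)) (suc m))
    ; start  = zero
    ; accept = λ q → toℕ q ≡ᵇ m
    }

  toℕ-δ*-cyclic : ∀ q v → toℕ (δ* cyclic q v) ≡ (toℕ q + length v) % suc m
  toℕ-δ*-cyclic q [] = sym (trans (cong (_% suc m) (+-identityʳ (toℕ q))) (m<n⇒m%n≡m (toℕ<n q)))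
  toℕ-δ*-cyclic q (a ∷ v) = begin
    toℕ (δ* cyclic q′ v)                     ≡⟨ toℕ-δ*-cyclic q′ v ⟩
    (toℕ q′ + length v) % suc m              ≡⟨ cong (λ r → (r + length v) % suc m) toℕ-q′ ⟩
    (suc (toℕ q) % suc m + length v) % suc m ≡⟨ [m%n+k]%n≡[m+k]%n (suc (toℕ q)) (length v) (suc m) ⟩
    (suc (toℕ q) + length v) % suc m         ≡⟨ cong (_% suc m) (+-suc (toℕ q) (length v)) ⟨
    (toℕ q + suc (length v)) % suc m         ∎
    where
    open ≡-Reasoning
    q′ = δ cyclic q a
    toℕ-q′ : toℕ q′ ≡ suc (toℕ q) % suc m
    toℕ-q′ = toℕ-fromℕ< (m%n<n (suc (toℕ q)) (suc m))

  accepts⇒%≡ : ∀ v → Accepts cyclic v → length v % suc m ≡ m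
  accepts⇒%≡ v accepted =
    trans (sym (toℕ-δ*-cyclic zero v)) (≡ᵇ⇒≡ _ m (Equivalence.from T-≡ accepted))

  %≡⇒accepts : ∀ v → length v % suc m ≡ m → Accepts cyclic v
  %≡⇒accepts v %≡m = Equivalence.to T-≡ (≡⇒≡ᵇ _ m (trans (toℕ-δ*-cyclic zero v) %≡m))

  witness-long : ∀ u w → Witness cyclic u w → 2 * suc m ∸ 1 ≤ length w
  witness-long u w (accepted-u , accepted-w , u⊆w , u≢w) =
    subst (_≤ length w) (cong (m +_) (sym (+-identityʳ (suc m))))
      (second-residue-≥ (⊆∧≢⇒length< u⊆w u≢w) (accepts⇒%≡ u accepted-u) (accepts⇒%≡ w accepted-w))

  not-subword-free : NotSubwordFree cyclic
  not-subword-free =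
    u , u ++ r , (%≡⇒accepts u ∣u∣%≡m , %≡⇒accepts (u ++ r) ∣w∣%≡m , ++⁺ʳ r ⊆-refl , u≢w)
    where
    u = replicate m zero
    r = replicate (suc m) zero
    ∣w∣≡m+1+m : length (u ++ r) ≡ m + suc m
    ∣w∣≡m+1+m = trans (length-++ u) (cong₂ _+_ (length-replicate m) (length-replicate (suc m)))
    ∣u∣%≡m : length u % suc m ≡ m
    ∣u∣%≡m = trans (cong (_% suc m) (length-replicate m)) (m<n⇒m%n≡m (n<1+n m))
    ∣w∣%≡m : length (u ++ r) % suc m ≡ m
    ∣w∣%≡m = trans (cong (_% suc m) ∣w∣≡m+1+m) (trans ([m+n]%n≡m%n m (suc m)) (m<n⇒m%n≡m (n<1+n m)))
    u≢w : u ≢ u ++ r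
    u≢w same = m+1+n≢m m (trans (sym ∣w∣≡m+1+m) (trans (cong length (sym same)) (length-replicate m)))

corollary7 : (n : ℕ) → 2 ≤ n →
    ((k : ℕ) (M : DFA k n) → NotSubwordFree M →
      Σ (List (Fin k)) λ u → Σ (List (Fin k)) λ w → Witness M u w × length w ≤ 2 * n ∸ 1)
    × (Σ (DFA 1 n) λ M → NotSubwordFree M ×
      ((u w : List (Fin 1)) → Witness M u w → 2 * n ∸ 1 ≤ length w))
corollary7 (suc m) _ =
  (λ k M (u , w , witness) → short-witness M (<-wellFounded (length w)) witness) ,
  (cyclic , not-subword-free , witness-long)
  where open Cyclic m
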